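{- Let $G_1,G_2$ be finite connected graphs. Suppose that for $i=1,2$, $G_i$ has a curvature $w_i$ with $K_i=\min_v w_i(v)\geq 0$, and that $G_i$ is discrete Bonnet--Myers sharp, i.e. $\operatorname{diam}(G_i)\cdot K_i=2$. Then the Cartesian product graph $G_1\square G_2$ is discrete Bonnet--Myers sharp: it has a curvature $w$ with $K=\min_v w(v)\geq 0$ and $\operatorname{diam}(G_1\square G_2)\cdot K=2$.
   Context: For a finite connected graph $G$ with vertices $v_1,\dots,v_n$ and distance matrix $D_{ij}=d(v_i,v_j)$ (shortest-path distance), a curvature of $G$ is a vector $w\in\mathbb{R}^n$ (a function on vertices) with $Dw=n\cdot\mathbf{1}$, where $\mathbf{1}$ is the all-ones vector. A graph is called discrete Bonnet--Myers sharp if it has a nonnegative curvature $w$ with $K=\min_i w_i\geq 0$ satisfying $\operatorname{diam}(G)\cdot K=2$. The Cartesian product $G_1\square G_2$ has vertex set $V(G_1)\times V(G_2)$, with $(a,b)\sim(a',b')$ iff ($a=a'$ and $b\sim b'$ in $G_2$) or ($b=b'$ and $a\sim a'$ in $G_1$).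
   Formalization: The curvatures w and their minima K take values in ℚ instead of ℝ, for $G_1$, $G_2$ and their product alike. -}

module Defs where

open import Data.Nat using (ℕ; zero; suc; _⊔_; _<_)
open import Data.Fin using (Fin; remQuot)
open import Data.Fin.Properties using (_≟_)
open import Data.Bool using (Bool; true; false; _∧_; _∨_; if_then_else_)
open import Data.List using (List; foldr; map; allFin)
open import Data.Bool.ListAction using (any)
open import Data.Product using (Σ; _×_; _,_; ∃)
open import Data.Integer using (+_)
open import Relation.Nullary using (does)
open import Relation.Binary.PropositionalEquality using (_≡_)
open import Data.Rational using (ℚ; 0ℚ; _≤_; _*_; _+_; _/_)

record Graph : Set where
  constructor mkGraph
  field
    n   : ℕ
    adj : Fin n → Fin n → Bool
open Graph public

IsSimple : Graph → Set
IsSimple G = (∀ u v → adj G u v ≡ adj G v u) × (∀ u → adj G u u ≡ false)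

reachIn : (G : Graph) → ℕ → Fin (n G) → Fin (n G) → Bool
reachIn G zero    u v = does (u ≟ v)
reachIn G (suc k) u v =
  reachIn G k u v ∨ any (λ x → adj G u x ∧ reachIn G k x v) (allFin (n G))

IsConnected : Graph → Set
IsConnected G = (0 < n G) × (∀ u v → ∃ λ k → reachIn G k u v ≡ true)

-- least i < bound (starting at i₀) with p i, or i₀ + bound if none
firstFrom : (ℕ → Bool) → ℕ → ℕ → ℕ
firstFrom p i zero      = i
firstFrom p i (suc m) = if p i then i else firstFrom p (suc i) m

-- shortest-path distance (in a connected graph on n vertices it is < n)
dist : (G : Graph) → Fin (n G) → Fin (n G) → ℕ
dist G u v = firstFrom (λ k → reachIn G k u v) 0 (n G)

maxList : List ℕ → ℕ
maxList = foldr _⊔_ 0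

diam : Graph → ℕ
diam G = maxList (Data.List.concatMap (λ u → map (dist G u) (allFin (n G))) (allFin (n G)))
  where import Data.List

sumℚ : List ℚ → ℚ
sumℚ = foldr _+_ 0ℚ

ℕtoℚ : ℕ → ℚ
ℕtoℚ k = (+ k) / 1

IsCurvature : (G : Graph) → (Fin (n G) → ℚ) → Set
IsCurvature G w = ∀ i →
  sumℚ (map (λ j → ℕtoℚ (dist G i j) * w j) (allFin (n G))) ≡ ℕtoℚ (n G)

IsMin : {m : ℕ} → (Fin m → ℚ) → ℚ → Set
IsMin w K = (∀ v → K ≤ w v) × (∃ λ v → w v ≡ K)

BMSharp : Graph → Set
BMSharp G = Σ (Fin (n G) → ℚ) λ w → IsCurvature G w × Σ ℚ λ K →
  IsMin w K × (0ℚ ≤ K) × (ℕtoℚ (diam G) * K ≡ ℕtoℚ 2)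

-- Cartesian product G₁ □ G₂, vertex (a , b) encoded as combine a b : Fin (n₁ * n₂)
_□_ : Graph → Graph → Graph
G₁ □ G₂ = mkGraph (n G₁ Data.Nat.* n G₂) a
  where
  import Data.Nat
  a : Fin (n G₁ Data.Nat.* n G₂) → Fin (n G₁ Data.Nat.* n G₂) → Bool
  a x y with remQuot (n G₂) x | remQuot (n G₂) y
  ... | (a₁ , b₁) | (a₂ , b₂) =
    (does (a₁ ≟ a₂) ∧ adj G₂ b₁ b₂) ∨ (does (b₁ ≟ b₂) ∧ adj G₁ a₁ a₂)

-- Let u, v realise the diameter δ of G.  By the triangle inequality δ ≤ d(u,x) + d(v,x), so adding
-- the rows u and v of D w = n·1 for a nonnegative curvature w gives δ·Σw ≤ 2n; when δ·K = 2 this is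
-- Σw ≤ nK, and K ≤ w gives the converse, hence Σw = nK.
-- Distances in G₁ □ G₂ are sums of distances in the factors, so w(a,b) = w₁(a) w₂(b) / (K₁ + K₂)
-- satisfies (D w)(a,b) = (n₁ Σw₂ + n₂ Σw₁) / (K₁ + K₂) = n₁ n₂.  Its minimum is
-- K₁ K₂ / (K₁ + K₂) = 2 / (δ₁ + δ₂), and G₁ □ G₂ has diameter δ₁ + δ₂.

module Submission where

open import Defs
open import Data.Product using (∃; ∃₂; _×_; _,_; proj₁; proj₂)
open import Relation.Binary.PropositionalEquality
  using (_≡_; _≢_; refl; sym; trans; cong; cong₂; subst; subst₂; module ≡-Reasoning)

module GraphMetric where
  open import Data.Bool using (Bool; true; false; T; T?; _∧_)
  open import Data.Bool.Properties using (T-≡; T-∨; T-∧)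
  open import Data.Empty using (⊥-elim)
  open import Data.Fin using (Fin; toℕ; fromℕ<; combine; remQuot)
  open import Data.Fin.Properties using (_≟_; pigeonhole; toℕ<n; remQuot-combine; combine-remQuot)
  open import Data.List using (List; map; allFin; concatMap)
  open import Data.List.Membership.Propositional using (_∈_; lose; find)
  open import Data.List.Membership.Propositional.Properties
    using (∈-allFin; ∈-map⁺; ∈-map⁻; ∈-concatMap⁺; ∈-concatMap⁻; foldr-selective)
  open import Data.List.Properties using (foldr-preservesᵒ; foldr-preservesᵇ)
  open import Data.List.Relation.Unary.All as All using ()
  open import Data.List.Relation.Unary.Any as Any using ()
  open import Data.List.Relation.Unary.Any.Properties using (any⁺; any⁻)
  open import Data.Nat using (ℕ; zero; suc; _+_; _≤_; _<_; _<?_; z≤n; s≤s)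
  open import Data.Nat.Properties
    using (≤-refl; ≤-reflexive; ≤-antisym; ≤-pred; ≮⇒≥; <⇒≱; <-irrefl; n≤0⇒n≡0; m≤n⇒m<n∨m≡n;
           +-identityʳ; +-suc; +-comm; +-mono-≤; +-monoˡ-≤; +-monoʳ-≤; m≤n⇒m≤1+n;
           ⊔-sel; ⊔-lub; m≤n⇒m≤n⊔o; m≤n⇒m≤o⊔n; module ≤-Reasoning)
  open import Data.Sum as Sum using (_⊎_; inj₁; inj₂; [_,_])
  open import Function using (_∘_; Equivalence)
  open import Relation.Nullary using (¬_; yes; no; does; contradiction)
  open import Relation.Nullary.Decidable using (dec-true)

  open Equivalence using (to; from)

  firstFrom-least : (p : ℕ → Bool) {m : ℕ} → T (p m) → (∀ {j} → j < m → ¬ T (p j)) →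
                    ∀ {i b} → i ≤ m → m < i + b → firstFrom p i b ≡ m
  firstFrom-least p pm below {i} {zero} i≤m m<i+0 =
    contradiction i≤m (<⇒≱ (subst (_ <_) (+-identityʳ i) m<i+0))
  firstFrom-least p {m} pm below {i} {suc b} i≤m m<i+b with p i in eq | m≤n⇒m<n∨m≡n i≤m
  ... | true  | inj₁ i<m  = contradiction (subst T (sym eq) _) (below i<m)
  ... | true  | inj₂ refl = refl
  ... | false | inj₁ i<m  = firstFrom-least p pm below i<m (subst (m <_) (+-suc i b) m<i+b)
  ... | false | inj₂ refl = ⊥-elim (subst T eq pm)

  ≟-complete : ∀ {m} {a b : Fin m} → a ≡ b → T (does (a ≟ b))
  ≟-complete {a = a} {b} a≡b = from T-≡ (dec-true (a ≟ b) a≡b)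

  ≟-sound : ∀ {m} {a b : Fin m} → T (does (a ≟ b)) → a ≡ b
  ≟-sound {a = a} {b} t with a ≟ b
  ... | yes a≡b = a≡b

  module Walks (G : Graph) where

    Vertex : Set
    Vertex = Fin (n G)

    Edge : Vertex → Vertex → Set
    Edge u v = T (adj G u v)

    -- A record, unlike T (reachIn G k u v), lets Agda infer k, u and v.
    record Reach (k : ℕ) (u v : Vertex) : Set where
      constructor walk
      field reachable : T (reachIn G k u v)

    private variable
      i j k m : ℕ
      u v w x : Vertex

    reach-refl : Reach 0 u u
    reach-refl {u} = walk (≟-complete {a = u} refl)

    reach-0⇒≡ : Reach 0 u v → u ≡ v
    reach-0⇒≡ (walk r) = ≟-sound r

    reach-suc : Reach k u v → Reach (suc k) u v
    reach-suc (walk r) = walk (from T-∨ (inj₁ r))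

    reach-∷ : Edge u x → Reach k x v → Reach (suc k) u v
    reach-∷ {x = x} e (walk r) = walk (from T-∨ (inj₂ (any⁺ _ (lose (∈-allFin x) (from T-∧ (e , r))))))

    reach-suc⁻ : Reach (suc k) u v → Reach k u v ⊎ ∃ λ x → Edge u x × Reach k x v
    reach-suc⁻ {k} {u} {v} (walk r) with to T-∨ r
    ... | inj₁ r′ = inj₁ (walk r′)
    ... | inj₂ r′ with find (any⁻ (λ x → adj G u x ∧ reachIn G k x v) (allFin (n G)) r′)
    ...   | x , _ , er = let e , r″ = to T-∧ er in inj₂ (x , e , walk r″)

    reach-mono : i ≤ j → Reach i u v → Reach j u v
    reach-mono i≤j r with m≤n⇒m<n∨m≡n i≤j
    reach-mono {j = suc j} _ r | inj₁ (s≤s i≤j) = reach-suc (reach-mono i≤j r)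
    ... | inj₂ refl = r

    reach-+ : Reach i u v → Reach j v w → Reach (i + j) u w
    reach-+ {zero} r s = subst (λ x → Reach _ x _) (sym (reach-0⇒≡ r)) s
    reach-+ {suc i} r s with reach-suc⁻ r
    ... | inj₁ r′ = reach-suc (reach-+ r′ s)
    ... | inj₂ (x , e , r′) = reach-∷ e (reach-+ r′ s)

    reach-sym : IsSimple G → Reach k u v → Reach k v u
    reach-sym {zero} _ r = subst (λ x → Reach 0 x _) (reach-0⇒≡ r) reach-refl
    reach-sym {suc k} {u} {v} simple r with reach-suc⁻ r
    ... | inj₁ r′ = reach-suc (reach-sym simple r′)
    ... | inj₂ (x , e , r′) = subst (λ l → Reach l v u) (+-comm k 1)
      (reach-+ (reach-sym simple r′) (reach-∷ (subst T (proj₁ simple _ _) e) reach-refl))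

    IsDistance : ℕ → Vertex → Vertex → Set
    IsDistance m u v = Reach m u v × (∀ {i} → i < m → ¬ Reach i u v)

    isDistance-unique : IsDistance i u v → IsDistance j u v → i ≡ j
    isDistance-unique (ri , li) (rj , lj) =
      ≤-antisym (≮⇒≥ (λ j<i → li j<i rj)) (≮⇒≥ (λ i<j → lj i<j ri))

    isDistance-pred : IsDistance (suc m) u v → ∃ λ x → IsDistance m x v
    isDistance-pred (r , least) with reach-suc⁻ r
    ... | inj₁ r′ = contradiction r′ (least ≤-refl)
    ... | inj₂ (x , e , r′) = x , r′ , λ i<m r″ → least (s≤s i<m) (reach-∷ e r″)

    isDistance-≤ : IsDistance m u v → j ≤ m → ∃ λ x → IsDistance j x v
    isDistance-≤ {m} {u} d j≤m with m≤n⇒m<n∨m≡n j≤m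
    ... | inj₂ refl = u , d
    isDistance-≤ {suc m} d _ | inj₁ (s≤s j≤m) =
      let x , d′ = isDistance-pred d in isDistance-≤ d′ j≤m

    reach⇒isDistance : Reach k u v → ∃ λ m → IsDistance m u v
    reach⇒isDistance {zero} r = 0 , r , λ ()
    reach⇒isDistance {suc k} {u} {v} r with T? (reachIn G k u v)
    ... | yes r′ = reach⇒isDistance {k} (walk r′)
    ... | no ¬r′ = suc k , r , λ i<sk rᵢ → ¬r′ (Reach.reachable (reach-mono (≤-pred i<sk) rᵢ))

    -- Pigeonhole: along a shortest walk the vertices at distances 0, …, m from v are pairwise distinct.
    isDistance-< : IsDistance m u v → m < n G
    isDistance-< {m} {u} {v} d with m <? n G
    ... | yes m<n = m<n
    ... | no m≮n =
      let i , j , i<j , same = pigeonhole (s≤s (≮⇒≥ m≮n)) (proj₁ ∘ atDistance)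
      in ⊥-elim (<-irrefl (isDistance-unique (proj₂ (atDistance i))
                             (subst (λ x → IsDistance (toℕ j) x v) (sym same) (proj₂ (atDistance j)))) i<j)
      where atDistance : (i : Fin (suc m)) → ∃ λ x → IsDistance (toℕ i) x v
            atDistance i = isDistance-≤ d (≤-pred (toℕ<n i))

    isDistance-dist : Reach k u v → IsDistance (dist G u v) u v
    isDistance-dist {u = u} {v} r with reach⇒isDistance r
    ... | m , d@(rm , least) = subst (λ l → IsDistance l u v) (sym dist≡m) d
      where dist≡m : dist G u v ≡ m
            dist≡m = firstFrom-least (λ l → reachIn G l u v) (Reach.reachable rm) (λ j<m → least j<m ∘ walk)
                                     z≤n (isDistance-< d)

    Connected : Set
    Connected = ∀ u v → ∃ λ k → Reach k u v

    isConnected⇒connected : IsConnected G → Connected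
    isConnected⇒connected (_ , c) u v = let k , r = c u v in k , walk (from T-≡ r)

  module Distance (G : Graph) (connected : Walks.Connected G) where
    open Walks G

    private variable
      k : ℕ
      u v w x : Vertex

    dist-isDistance : IsDistance (dist G u v) u v
    dist-isDistance {u} {v} = isDistance-dist (proj₂ (connected u v))

    dist-reach : Reach (dist G u v) u v
    dist-reach = proj₁ dist-isDistance

    dist-least : Reach k u v → dist G u v ≤ k
    dist-least r = ≮⇒≥ (λ k<d → proj₂ dist-isDistance k<d r)

    dist-refl : dist G u u ≡ 0
    dist-refl = n≤0⇒n≡0 (dist-least reach-refl)

    dist-triangle : dist G u w ≤ dist G u v + dist G v w
    dist-triangle = dist-least (reach-+ dist-reach dist-reach)

    dist-∷ : Edge u x → dist G u v ≤ suc (dist G x v)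
    dist-∷ e = dist-least (reach-∷ e dist-reach)

    dist-sym : IsSimple G → dist G u v ≡ dist G v u
    dist-sym simple = ≤-antisym (dist-least (reach-sym simple dist-reach))
                                (dist-least (reach-sym simple dist-reach))

  ≤-maxList : ∀ {x xs} → x ∈ xs → x ≤ maxList xs
  ≤-maxList x∈xs = foldr-preservesᵒ (λ a b → [ m≤n⇒m≤n⊔o b , m≤n⇒m≤o⊔n a ]) 0 _
    (inj₂ (Any.map ≤-reflexive x∈xs))

  maxList-≤ : ∀ {xs b} → (∀ {x} → x ∈ xs → x ≤ b) → maxList xs ≤ b
  maxList-≤ below = foldr-preservesᵇ ⊔-lub z≤n (All.tabulate below)

  maxList-∈ : ∀ {x xs} → x ∈ xs → maxList xs ∈ xs
  maxList-∈ {x} {xs} x∈xs with foldr-selective ⊔-sel 0 xs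
  ... | inj₂ max∈xs = max∈xs
  ... | inj₁ max≡0 =
    subst (_∈ xs) (trans (n≤0⇒n≡0 (subst (x ≤_) max≡0 (≤-maxList x∈xs))) (sym max≡0)) x∈xs

  module Diameter (G : Graph) where
    open Walks G using (Vertex)

    row : Vertex → List ℕ
    row u = map (dist G u) (allFin (n G))

    distances : List ℕ
    distances = concatMap row (allFin (n G))

    dist∈distances : ∀ {u v} → dist G u v ∈ distances
    dist∈distances {u} {v} = ∈-concatMap⁺ row (lose (∈-allFin u) (∈-map⁺ _ (∈-allFin v)))

    ∈-distances⁻ : ∀ {d} → d ∈ distances → ∃₂ λ u v → d ≡ dist G u v
    ∈-distances⁻ d∈ with find (∈-concatMap⁻ row {allFin (n G)} d∈)
    ... | u , _ , d∈row with ∈-map⁻ _ d∈row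
    ...   | v , _ , d≡ = u , v , d≡

    dist≤diam : ∀ {u v} → dist G u v ≤ diam G
    dist≤diam = ≤-maxList dist∈distances

    diam-least : ∀ {b} → (∀ u v → dist G u v ≤ b) → diam G ≤ b
    diam-least below = maxList-≤ λ d∈ →
      let u , v , d≡ = ∈-distances⁻ d∈ in subst (_≤ _) (sym d≡) (below u v)

    diam-attained : 0 < n G → ∃₂ λ u v → dist G u v ≡ diam G
    diam-attained 0<n with ∈-distances⁻ (maxList-∈ (dist∈distances {fromℕ< 0<n} {fromℕ< 0<n}))
    ... | u , v , diam≡ = u , v , sym diam≡

  module Product (G₁ G₂ : Graph) where
    open Walks (G₁ □ G₂)
    private
      module W₁ = Walks G₁
      module W₂ = Walks G₂
      variable
        i j : ℕ
        a a′ : W₁.Vertex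
        b b′ : W₂.Vertex
        x y : Vertex

    fst : Vertex → W₁.Vertex
    fst x = proj₁ (remQuot {n G₁} (n G₂) x)

    snd : Vertex → W₂.Vertex
    snd x = proj₂ (remQuot {n G₁} (n G₂) x)

    fst-combine : fst (combine a b) ≡ a
    fst-combine {a} {b} = cong proj₁ (remQuot-combine {n G₁} {n G₂} a b)

    snd-combine : snd (combine a b) ≡ b
    snd-combine {a} {b} = cong proj₂ (remQuot-combine {n G₁} {n G₂} a b)

    combine-fst-snd : combine (fst x) (snd x) ≡ x
    combine-fst-snd {x} = combine-remQuot {n G₁} (n G₂) x

    edge⁻ : Edge x y →
            (fst x ≡ fst y × W₂.Edge (snd x) (snd y)) ⊎ (snd x ≡ snd y × W₁.Edge (fst x) (fst y))
    edge⁻ {x} {y} e = Sum.map sound sound (to (T-∨ {x = does (fst x ≟ fst y) ∧ adj G₂ (snd x) (snd y)}) e)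
      where sound : ∀ {m c} {p q : Fin m} → T (does (p ≟ q) ∧ c) → p ≡ q × T c
            sound t = let p≡q , tc = to T-∧ t in ≟-sound p≡q , tc

    edge⁺ : (fst x ≡ fst y × W₂.Edge (snd x) (snd y)) ⊎ (snd x ≡ snd y × W₁.Edge (fst x) (fst y)) →
            Edge x y
    edge⁺ {x} {y} =
      from (T-∨ {x = does (fst x ≟ fst y) ∧ adj G₂ (snd x) (snd y)}) ∘ Sum.map complete complete
      where complete : ∀ {m c} {p q : Fin m} → p ≡ q × T c → T (does (p ≟ q) ∧ c)
            complete (p≡q , tc) = from T-∧ (≟-complete p≡q , tc)

    edge-combineʳ : W₂.Edge b b′ → Edge (combine a b) (combine a b′)
    edge-combineʳ e =
      edge⁺ (inj₁ (trans fst-combine (sym fst-combine) , subst₂ W₂.Edge (sym snd-combine) (sym snd-combine) e))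

    edge-combineˡ : W₁.Edge a a′ → Edge (combine a b) (combine a′ b)
    edge-combineˡ e =
      edge⁺ (inj₂ (trans snd-combine (sym snd-combine) , subst₂ W₁.Edge (sym fst-combine) (sym fst-combine) e))

    reach-combineʳ : W₂.Reach j b b′ → Reach j (combine a b) (combine a b′)
    reach-combineʳ {j = zero} {b = b} {a = a} r =
      subst (λ c → Reach 0 (combine a b) (combine a c)) (W₂.reach-0⇒≡ r) reach-refl
    reach-combineʳ {j = suc j} r with W₂.reach-suc⁻ r
    ... | inj₁ r′ = reach-suc (reach-combineʳ r′)
    ... | inj₂ (_ , e , r′) = reach-∷ (edge-combineʳ e) (reach-combineʳ r′)

    reach-combine : W₁.Reach i a a′ → W₂.Reach j b b′ → Reach (i + j) (combine a b) (combine a′ b′)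
    reach-combine {i = zero} {a = a} {b = b} {b′ = b′} r s =
      subst (λ c → Reach _ (combine a b) (combine c b′)) (W₁.reach-0⇒≡ r) (reach-combineʳ s)
    reach-combine {i = suc i} r s with W₁.reach-suc⁻ r
    ... | inj₁ r′ = reach-suc (reach-combine r′ s)
    ... | inj₂ (_ , e , r′) = reach-∷ (edge-combineˡ e) (reach-combine r′ s)

  module ProductDistance (G₁ G₂ : Graph) (connected₁ : Walks.Connected G₁) (connected₂ : Walks.Connected G₂)
    where
    open Walks (G₁ □ G₂)
    open Product G₁ G₂
    private
      module D₁ = Distance G₁ connected₁
      module D₂ = Distance G₂ connected₂
      module Diam = Diameter (G₁ □ G₂)
      module Diam₁ = Diameter G₁
      module Diam₂ = Diameter G₂
      variable
        k : ℕ
        x y : Vertex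

    dist₁+dist₂ : Vertex → Vertex → ℕ
    dist₁+dist₂ x y = dist G₁ (fst x) (fst y) + dist G₂ (snd x) (snd y)

    reach-dist₁+dist₂ : Reach (dist₁+dist₂ x y) x y
    reach-dist₁+dist₂ =
      subst₂ (Reach _) combine-fst-snd combine-fst-snd (reach-combine D₁.dist-reach D₂.dist-reach)

    connected : Connected
    connected x y = _ , reach-dist₁+dist₂

    dist₁+dist₂-least : Reach k x y → dist₁+dist₂ x y ≤ k
    dist₁+dist₂-least {zero} {x} r = subst (λ z → dist₁+dist₂ x z ≤ 0) (reach-0⇒≡ r)
      (≤-reflexive (cong₂ _+_ D₁.dist-refl D₂.dist-refl))
    dist₁+dist₂-least {suc k} {x} {y} r with reach-suc⁻ r
    ... | inj₁ r′ = m≤n⇒m≤1+n (dist₁+dist₂-least r′)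
    ... | inj₂ (z , e , r′) with edge⁻ e
    ...   | inj₁ (fx≡fz , e₂) = begin
      dist G₁ (fst x) (fst y) + dist G₂ (snd x) (snd y)
        ≡⟨ cong (λ a → dist G₁ a (fst y) + dist G₂ (snd x) (snd y)) fx≡fz ⟩
      dist G₁ (fst z) (fst y) + dist G₂ (snd x) (snd y)
        ≤⟨ +-monoʳ-≤ (dist G₁ (fst z) (fst y)) (D₂.dist-∷ e₂) ⟩
      dist G₁ (fst z) (fst y) + suc (dist G₂ (snd z) (snd y))
        ≡⟨ +-suc _ _ ⟩
      suc (dist₁+dist₂ z y)
        ≤⟨ s≤s (dist₁+dist₂-least r′) ⟩
      suc k ∎
      where open ≤-Reasoning
    ...   | inj₂ (sx≡sz , e₁) = begin
      dist G₁ (fst x) (fst y) + dist G₂ (snd x) (snd y)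
        ≡⟨ cong (λ b → dist G₁ (fst x) (fst y) + dist G₂ b (snd y)) sx≡sz ⟩
      dist G₁ (fst x) (fst y) + dist G₂ (snd z) (snd y)
        ≤⟨ +-monoˡ-≤ (dist G₂ (snd z) (snd y)) (D₁.dist-∷ e₁) ⟩
      suc (dist₁+dist₂ z y)
        ≤⟨ s≤s (dist₁+dist₂-least r′) ⟩
      suc k ∎
      where open ≤-Reasoning

    dist-□ : dist (G₁ □ G₂) x y ≡ dist₁+dist₂ x y
    dist-□ = ≤-antisym (D.dist-least reach-dist₁+dist₂) (dist₁+dist₂-least D.dist-reach)
      where module D = Distance (G₁ □ G₂) connected

    dist-combineʳ : ∀ {a b} → dist (G₁ □ G₂) x (combine a b) ≡ dist G₁ (fst x) a + dist G₂ (snd x) b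
    dist-combineʳ = trans dist-□ (cong₂ _+_ (cong (dist G₁ _) fst-combine) (cong (dist G₂ _) snd-combine))

    diam-□ : 0 < n G₁ → 0 < n G₂ → diam (G₁ □ G₂) ≡ diam G₁ + diam G₂
    diam-□ 0<n₁ 0<n₂ with Diam₁.diam-attained 0<n₁ | Diam₂.diam-attained 0<n₂
    ... | u₁ , v₁ , d₁≡ | u₂ , v₂ , d₂≡ = ≤-antisym
      (Diam.diam-least λ x y → subst (_≤ _) (sym dist-□) (+-mono-≤ Diam₁.dist≤diam Diam₂.dist≤diam))
      (subst (_≤ diam (G₁ □ G₂)) diam₁+diam₂-attained Diam.dist≤diam)
      where
        diam₁+diam₂-attained : dist (G₁ □ G₂) (combine u₁ u₂) (combine v₁ v₂) ≡ diam G₁ + diam G₂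
        diam₁+diam₂-attained = trans dist-combineʳ
          (cong₂ _+_ (trans (cong (λ a → dist G₁ a v₁) fst-combine) d₁≡)
                     (trans (cong (λ b → dist G₂ b v₂) snd-combine) d₂≡))

open GraphMetric

open import Algebra.Bundles using (Ring)
open import Data.Fin using (Fin; zero; suc; combine; _↑ˡ_; _↑ʳ_)
import Data.Integer as ℤ
import Data.Integer.Properties as ℤ
open import Data.List using (map; tabulate)
import Data.Nat as ℕ
import Data.Nat.Coprimality as Coprime
open import Data.Rational
  using (ℚ; mkℚ; 0ℚ; 1ℚ; _+_; _*_; _≤_; _/_; 1/_; Positive; NonZero; *≤*; nonNegative; ≢-nonZero)
open import Data.Rational.Properties
  using (normalize-coprime; nonNeg∧nonZero⇒pos; pos⇒nonZero; pos+nonNeg⇒pos; 1/pos⇒pos; positive⁻¹;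
         nonNegative⁻¹; nonNeg*nonNeg⇒nonNeg; ≤-refl; ≤-trans; ≤-antisym; <⇒≤; module ≤-Reasoning;
         +-identityˡ; +-assoc; +-mono-≤; *-zeroˡ; *-zeroʳ; *-identityˡ; *-identityʳ; *-inverseˡ;
         *-distribʳ-+; *-monoˡ-≤-nonNeg; *-monoʳ-≤-nonNeg; *-cancelˡ-≤-pos; +-*-ring)
open import Data.Rational.Solver using (module +-*-Solver)
open import Algebra.Properties.Semiring.Sum (Ring.semiring +-*-ring)
  using (sum; sum-syntax; sum-cong-≗; ∑-distrib-+; *-distribˡ-sum; *-distribʳ-sum)

open +-*-Solver

ℕtoℚ≡mkℚ : ∀ k → ℕtoℚ k ≡ mkℚ (ℤ.+ k) 0 (Coprime.sym (Coprime.1-coprimeTo k))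
ℕtoℚ≡mkℚ k = normalize-coprime (Coprime.sym (Coprime.1-coprimeTo k))

ℕtoℚ-+ : ∀ a b → ℕtoℚ (a ℕ.+ b) ≡ ℕtoℚ a + ℕtoℚ b
ℕtoℚ-+ a b rewrite ℕtoℚ≡mkℚ a | ℕtoℚ≡mkℚ b =
  sym (cong (_/ 1) (cong₂ ℤ._+_ (ℤ.*-identityʳ (ℤ.+ a)) (ℤ.*-identityʳ (ℤ.+ b))))

ℕtoℚ-* : ∀ a b → ℕtoℚ (a ℕ.* b) ≡ ℕtoℚ a * ℕtoℚ b
ℕtoℚ-* a b rewrite ℕtoℚ≡mkℚ a | ℕtoℚ≡mkℚ b = cong (_/ 1) (ℤ.pos-* a b)

ℕtoℚ-mono-≤ : ∀ {a b} → a ℕ.≤ b → ℕtoℚ a ≤ ℕtoℚ b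
ℕtoℚ-mono-≤ {a} {b} a≤b rewrite ℕtoℚ≡mkℚ a | ℕtoℚ≡mkℚ b =
  *≤* (ℤ.*-monoʳ-≤-nonNeg (ℤ.+ 1) (ℤ.+≤+ a≤b))

ℕtoℚ-nonNeg : ∀ a → 0ℚ ≤ ℕtoℚ a
ℕtoℚ-nonNeg a = ℕtoℚ-mono-≤ {0} {a} ℕ.z≤n

*-nonNeg : ∀ {p q} → 0ℚ ≤ p → 0ℚ ≤ q → 0ℚ ≤ p * q
*-nonNeg {p} {q} 0≤p 0≤q =
  nonNegative⁻¹ (p * q) {{nonNeg*nonNeg⇒nonNeg p {{nonNegative 0≤p}} q {{nonNegative 0≤q}}}}

*≡2⇒positive : ∀ {p q} → 0ℚ ≤ p → 0ℚ ≤ q → p * q ≡ ℕtoℚ 2 → Positive p × Positive q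
*≡2⇒positive {p} {q} 0≤p 0≤q pq≡2 =
  nonNeg∧nonZero⇒pos p {{nonNegative 0≤p}} {{≢-nonZero p≢0}} ,
  nonNeg∧nonZero⇒pos q {{nonNegative 0≤q}} {{≢-nonZero q≢0}}
  where
  0≢2 : 0ℚ ≢ ℕtoℚ 2
  0≢2 ()
  p≢0 : p ≢ 0ℚ
  p≢0 refl = 0≢2 (trans (sym (*-zeroˡ q)) pq≡2)
  q≢0 : q ≢ 0ℚ
  q≢0 refl = 0≢2 (trans (sym (*-zeroʳ p)) pq≡2)

sumℚ-tabulate : ∀ {A : Set} {m} (f : A → ℚ) (g : Fin m → A) →
                sumℚ (map f (tabulate g)) ≡ ∑[ i < m ] f (g i)
sumℚ-tabulate {m = ℕ.zero}  f g = refl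
sumℚ-tabulate {m = ℕ.suc m} f g = cong (f (g zero) +_) (sumℚ-tabulate f (λ i → g (suc i)))

sum-mono-≤ : ∀ {m} {f g : Fin m → ℚ} → (∀ i → f i ≤ g i) → sum f ≤ sum g
sum-mono-≤ {ℕ.zero}  f≤g = ≤-refl
sum-mono-≤ {ℕ.suc m} f≤g = +-mono-≤ (f≤g zero) (sum-mono-≤ (λ i → f≤g (suc i)))

sum-const : ∀ m c → ∑[ i < m ] c ≡ ℕtoℚ m * c
sum-const ℕ.zero    c = sym (*-zeroˡ c)
sum-const (ℕ.suc m) c rewrite sum-const m c | ℕtoℚ-+ 1 m =
  solve 2 (λ c x → c :+ x :* c := (con 1ℚ :+ x) :* c) refl c (ℕtoℚ m)

sum-↑ : ∀ k {t} (f : Fin (k ℕ.+ t) → ℚ) → sum f ≡ ∑[ i < k ] f (i ↑ˡ t) + ∑[ j < t ] f (k ↑ʳ j)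
sum-↑ ℕ.zero        f = sym (+-identityˡ _)
sum-↑ (ℕ.suc k) {t} f rewrite sum-↑ k (λ i → f (suc i)) =
  sym (+-assoc (f zero) (∑[ i < k ] f (suc (i ↑ˡ t))) (∑[ j < t ] f (suc (k ↑ʳ j))))

sum-combine : ∀ m k (f : Fin (m ℕ.* k) → ℚ) → sum f ≡ ∑[ a < m ] ∑[ b < k ] f (combine a b)
sum-combine ℕ.zero    k f = refl
sum-combine (ℕ.suc m) k f =
  trans (sum-↑ k f) (cong (∑[ j < k ] f (j ↑ˡ (m ℕ.* k)) +_) (sum-combine m k (λ x → f (k ↑ʳ x))))

distSum : (G : Graph) → (Fin (n G) → ℚ) → Fin (n G) → ℚ
distSum G w u = ∑[ v < n G ] (ℕtoℚ (dist G u v) * w v)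

isCurvature⇒distSum : ∀ G {w} → IsCurvature G w → ∀ u → distSum G w u ≡ ℕtoℚ (n G)
isCurvature⇒distSum G {w} curvature u =
  trans (sym (sumℚ-tabulate (λ v → ℕtoℚ (dist G u v) * w v) (λ v → v))) (curvature u)

distSum⇒isCurvature : ∀ G {w} → (∀ u → distSum G w u ≡ ℕtoℚ (n G)) → IsCurvature G w
distSum⇒isCurvature G {w} Dw≡n u = trans (sumℚ-tabulate (λ v → ℕtoℚ (dist G u v) * w v) (λ v → v)) (Dw≡n u)

distSum-scale : ∀ G c w u → distSum G (λ v → c * w v) u ≡ c * distSum G w u
distSum-scale G c w u = trans
  (sum-cong-≗ λ v → solve 3 (λ d c x → d :* (c :* x) := c :* (d :* x)) refl (ℕtoℚ (dist G u v)) c (w v))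
  (sym (*-distribˡ-sum c (λ v → ℕtoℚ (dist G u v) * w v)))

diam*sum≤2*n : ∀ G → IsSimple G → IsConnected G → ∀ {w} → IsCurvature G w → (∀ v → 0ℚ ≤ w v) →
               ℕtoℚ (diam G) * sum w ≤ ℕtoℚ 2 * ℕtoℚ (n G)
diam*sum≤2*n G simple connected@(0<n , _) {w} curvature 0≤w
  with Diameter.diam-attained G 0<n
... | u , v , duv≡diam = begin
  D * sum w                                 ≡⟨ *-distribˡ-sum D w ⟩
  ∑[ x < n G ] (D * w x)                    ≤⟨ sum-mono-≤ D*w≤ ⟩
  ∑[ x < n G ] ((d u x + d v x) * w x)      ≡⟨ sum-cong-≗ (λ x → *-distribʳ-+ (w x) (d u x) (d v x)) ⟩
  ∑[ x < n G ] (d u x * w x + d v x * w x)  ≡⟨ ∑-distrib-+ (λ x → d u x * w x) (λ x → d v x * w x) ⟩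
  distSum G w u + distSum G w v             ≡⟨ cong₂ _+_ (isCurvature⇒distSum G curvature u)
                                                         (isCurvature⇒distSum G curvature v) ⟩
  N + N                                     ≡⟨ solve 1 (λ N → N :+ N := (con 1ℚ :+ con 1ℚ) :* N) refl N ⟩
  ℕtoℚ 2 * N                                ∎
  where
  open ≤-Reasoning
  open Distance G (Walks.isConnected⇒connected G connected)
  D = ℕtoℚ (diam G)
  N = ℕtoℚ (n G)
  d : Fin (n G) → Fin (n G) → ℚ
  d x y = ℕtoℚ (dist G x y)
  D*w≤ : ∀ x → D * w x ≤ (d u x + d v x) * w x
  D*w≤ x = *-monoʳ-≤-nonNeg (w x) {{nonNegative (0≤w x)}}
    (subst₂ _≤_ (cong ℕtoℚ duv≡diam) (ℕtoℚ-+ (dist G u x) (dist G v x))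
      (ℕtoℚ-mono-≤ (subst (λ t → dist G u v ℕ.≤ dist G u x ℕ.+ t) (dist-sym simple) dist-triangle)))

sum-sharp : ∀ G → IsSimple G → IsConnected G → ∀ {w K} → IsCurvature G w → IsMin w K → 0ℚ ≤ K →
            ℕtoℚ (diam G) * K ≡ ℕtoℚ 2 → sum w ≡ ℕtoℚ (n G) * K
sum-sharp G simple connected {w} {K} curvature (K≤w , _) 0≤K sharp = ≤-antisym upper lower
  where
  D = ℕtoℚ (diam G)
  N = ℕtoℚ (n G)
  lower : N * K ≤ sum w
  lower = subst (_≤ sum w) (sum-const (n G) K) (sum-mono-≤ K≤w)
  upper : sum w ≤ N * K
  upper = *-cancelˡ-≤-pos D {{proj₁ (*≡2⇒positive (ℕtoℚ-nonNeg (diam G)) 0≤K sharp)}} (begin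
    D * sum w      ≤⟨ diam*sum≤2*n G simple connected curvature (λ v → ≤-trans 0≤K (K≤w v)) ⟩
    ℕtoℚ 2 * N     ≡⟨ cong (_* N) (sym sharp) ⟩
    D * K * N      ≡⟨ solve 3 (λ D K N → D :* K :* N := D :* (N :* K)) refl D K N ⟩
    D * (N * K)    ∎)
    where open ≤-Reasoning

isMin-scale : ∀ {m} {w : Fin m → ℚ} {K c} → 0ℚ ≤ c → IsMin w K → IsMin (λ v → c * w v) (c * K)
isMin-scale {c = c} 0≤c (K≤w , v , wv≡K) =
  (λ u → *-monoˡ-≤-nonNeg c {{nonNegative 0≤c}} (K≤w u)) , v , cong (c *_) wv≡K

*-harmonic : ∀ D₁ D₂ K₁ K₂ c → D₁ * K₁ ≡ ℕtoℚ 2 → D₂ * K₂ ≡ ℕtoℚ 2 → c * (K₁ + K₂) ≡ 1ℚ →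
             (D₁ + D₂) * (c * (K₁ * K₂)) ≡ ℕtoℚ 2
*-harmonic D₁ D₂ K₁ K₂ c D₁K₁≡2 D₂K₂≡2 c[K₁+K₂]≡1 = begin
  (D₁ + D₂) * (c * (K₁ * K₂))
    ≡⟨ solve 5 (λ a b c k l → (a :+ b) :* (c :* (k :* l)) := c :* (a :* k :* l :+ b :* l :* k))
               refl D₁ D₂ c K₁ K₂ ⟩
  c * (D₁ * K₁ * K₂ + D₂ * K₂ * K₁)
    ≡⟨ cong₂ (λ s t → c * (s * K₂ + t * K₁)) D₁K₁≡2 D₂K₂≡2 ⟩
  c * (ℕtoℚ 2 * K₂ + ℕtoℚ 2 * K₁)
    ≡⟨ solve 4 (λ c t k l → c :* (t :* l :+ t :* k) := t :* (c :* (k :+ l))) refl c (ℕtoℚ 2) K₁ K₂ ⟩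
  ℕtoℚ 2 * (c * (K₁ + K₂))
    ≡⟨ cong (ℕtoℚ 2 *_) c[K₁+K₂]≡1 ⟩
  ℕtoℚ 2 * 1ℚ
    ≡⟨ *-identityʳ (ℕtoℚ 2) ⟩
  ℕtoℚ 2 ∎
  where open ≡-Reasoning

module ProductCurvature (G₁ G₂ : Graph) where
  open Product G₁ G₂

  _⊗_ : (Fin (n G₁) → ℚ) → (Fin (n G₂) → ℚ) → Fin (n (G₁ □ G₂)) → ℚ
  (w₁ ⊗ w₂) x = w₁ (fst x) * w₂ (snd x)

  isMin-⊗ : ∀ {w₁ w₂ K₁ K₂} → IsMin w₁ K₁ → IsMin w₂ K₂ → 0ℚ ≤ K₁ → 0ℚ ≤ K₂ → IsMin (w₁ ⊗ w₂) (K₁ * K₂)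
  isMin-⊗ {w₁} {w₂} {K₁} {K₂} (K₁≤w₁ , v₁ , w₁v₁≡K₁) (K₂≤w₂ , v₂ , w₂v₂≡K₂) 0≤K₁ 0≤K₂ =
    (λ x → ≤-trans (*-monoʳ-≤-nonNeg K₂ {{nonNegative 0≤K₂}} (K₁≤w₁ (fst x)))
                   (*-monoˡ-≤-nonNeg (w₁ (fst x)) {{nonNegative (≤-trans 0≤K₁ (K₁≤w₁ (fst x)))}}
                                     (K₂≤w₂ (snd x)))) ,
    combine v₁ v₂ , cong₂ _*_ (trans (cong w₁ fst-combine) w₁v₁≡K₁) (trans (cong w₂ snd-combine) w₂v₂≡K₂)

  module _ (connected₁ : IsConnected G₁) (connected₂ : IsConnected G₂) where
    open ProductDistance G₁ G₂ (Walks.isConnected⇒connected G₁ connected₁)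
                               (Walks.isConnected⇒connected G₂ connected₂)

    -- The distance matrix of G₁ □ G₂ is D₁ ⊗ J + J ⊗ D₂.
    distSum-⊗ : ∀ w₁ w₂ x →
                distSum (G₁ □ G₂) (w₁ ⊗ w₂) x ≡ distSum G₁ w₁ (fst x) * sum w₂ + sum w₁ * distSum G₂ w₂ (snd x)
    distSum-⊗ w₁ w₂ x = begin
      distSum (G₁ □ G₂) (w₁ ⊗ w₂) x
        ≡⟨ sum-combine (n G₁) (n G₂) _ ⟩
      ∑[ a < n G₁ ] ∑[ b < n G₂ ] (ℕtoℚ (dist (G₁ □ G₂) x (combine a b)) * (w₁ ⊗ w₂) (combine a b))
        ≡⟨ sum-cong-≗ (λ a → sum-cong-≗ (entry a)) ⟩
      ∑[ a < n G₁ ] ∑[ b < n G₂ ] (X a * w₂ b + w₁ a * Y b)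
        ≡⟨ sum-cong-≗ row ⟩
      ∑[ a < n G₁ ] (X a * sum w₂ + w₁ a * sum Y)
        ≡⟨ ∑-distrib-+ (λ a → X a * sum w₂) (λ a → w₁ a * sum Y) ⟩
      ∑[ a < n G₁ ] (X a * sum w₂) + ∑[ a < n G₁ ] (w₁ a * sum Y)
        ≡⟨ cong₂ _+_ (*-distribʳ-sum (sum w₂) X) (*-distribʳ-sum (sum Y) w₁) ⟨
      sum X * sum w₂ + sum w₁ * sum Y ∎
      where
      open ≡-Reasoning
      X : Fin (n G₁) → ℚ
      X a = ℕtoℚ (dist G₁ (fst x) a) * w₁ a
      Y : Fin (n G₂) → ℚ
      Y b = ℕtoℚ (dist G₂ (snd x) b) * w₂ b
      entry : ∀ a b → ℕtoℚ (dist (G₁ □ G₂) x (combine a b)) * (w₁ ⊗ w₂) (combine a b) ≡ X a * w₂ b + w₁ a * Y b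
      entry a b = begin
        ℕtoℚ (dist (G₁ □ G₂) x (combine a b)) * (w₁ ⊗ w₂) (combine a b)
          ≡⟨ cong₂ (λ d c → ℕtoℚ d * c) dist-combineʳ (cong₂ _*_ (cong w₁ fst-combine) (cong w₂ snd-combine)) ⟩
        ℕtoℚ (d₁ ℕ.+ d₂) * (w₁ a * w₂ b)
          ≡⟨ cong (_* (w₁ a * w₂ b)) (ℕtoℚ-+ d₁ d₂) ⟩
        (ℕtoℚ d₁ + ℕtoℚ d₂) * (w₁ a * w₂ b)
          ≡⟨ solve 4 (λ d e p q → (d :+ e) :* (p :* q) := d :* p :* q :+ p :* (e :* q))
                     refl (ℕtoℚ d₁) (ℕtoℚ d₂) (w₁ a) (w₂ b) ⟩
        X a * w₂ b + w₁ a * Y b ∎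
        where d₁ = dist G₁ (fst x) a
              d₂ = dist G₂ (snd x) b
      row : ∀ a → ∑[ b < n G₂ ] (X a * w₂ b + w₁ a * Y b) ≡ X a * sum w₂ + w₁ a * sum Y
      row a = trans (∑-distrib-+ (λ b → X a * w₂ b) (λ b → w₁ a * Y b))
                    (sym (cong₂ _+_ (*-distribˡ-sum (X a) w₂) (*-distribˡ-sum (w₁ a) Y)))

    isCurvature-⊗ : ∀ {w₁ w₂ K₁ K₂} c → IsCurvature G₁ w₁ → IsCurvature G₂ w₂ →
                    sum w₁ ≡ ℕtoℚ (n G₁) * K₁ → sum w₂ ≡ ℕtoℚ (n G₂) * K₂ → c * (K₁ + K₂) ≡ 1ℚ →
                    IsCurvature (G₁ □ G₂) (λ x → c * (w₁ ⊗ w₂) x)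
    isCurvature-⊗ {w₁} {w₂} {K₁} {K₂} c curvature₁ curvature₂ sum₁ sum₂ c[K₁+K₂]≡1 =
      distSum⇒isCurvature (G₁ □ G₂) λ x → begin
        distSum (G₁ □ G₂) (λ y → c * (w₁ ⊗ w₂) y) x
          ≡⟨ distSum-scale (G₁ □ G₂) c (w₁ ⊗ w₂) x ⟩
        c * distSum (G₁ □ G₂) (w₁ ⊗ w₂) x
          ≡⟨ cong (c *_) (distSum-⊗ w₁ w₂ x) ⟩
        c * (distSum G₁ w₁ (fst x) * sum w₂ + sum w₁ * distSum G₂ w₂ (snd x))
          ≡⟨ cong (c *_) (cong₂ _+_ (cong₂ _*_ (isCurvature⇒distSum G₁ curvature₁ (fst x)) sum₂)
                                    (cong₂ _*_ sum₁ (isCurvature⇒distSum G₂ curvature₂ (snd x)))) ⟩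
        c * (N₁ * (N₂ * K₂) + N₁ * K₁ * N₂)
          ≡⟨ solve 5 (λ c a b k l → c :* (a :* (b :* l) :+ a :* k :* b) := c :* (k :+ l) :* (a :* b))
                     refl c N₁ N₂ K₁ K₂ ⟩
        c * (K₁ + K₂) * (N₁ * N₂)
          ≡⟨ cong (_* (N₁ * N₂)) c[K₁+K₂]≡1 ⟩
        1ℚ * (N₁ * N₂)
          ≡⟨ *-identityˡ (N₁ * N₂) ⟩
        N₁ * N₂
          ≡⟨ ℕtoℚ-* (n G₁) (n G₂) ⟨
        ℕtoℚ (n G₁ ℕ.* n G₂) ∎
      where
      open ≡-Reasoning
      N₁ = ℕtoℚ (n G₁)
      N₂ = ℕtoℚ (n G₂)

    sharp-□ : ∀ {K₁ K₂} c → ℕtoℚ (diam G₁) * K₁ ≡ ℕtoℚ 2 → ℕtoℚ (diam G₂) * K₂ ≡ ℕtoℚ 2 →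
              c * (K₁ + K₂) ≡ 1ℚ → ℕtoℚ (diam (G₁ □ G₂)) * (c * (K₁ * K₂)) ≡ ℕtoℚ 2
    sharp-□ {K₁} {K₂} c sharp₁ sharp₂ c[K₁+K₂]≡1 = begin
      ℕtoℚ (diam (G₁ □ G₂)) * (c * (K₁ * K₂))
        ≡⟨ cong (λ d → ℕtoℚ d * (c * (K₁ * K₂))) (diam-□ (proj₁ connected₁) (proj₁ connected₂)) ⟩
      ℕtoℚ (diam G₁ ℕ.+ diam G₂) * (c * (K₁ * K₂))
        ≡⟨ cong (_* (c * (K₁ * K₂))) (ℕtoℚ-+ (diam G₁) (diam G₂)) ⟩
      (ℕtoℚ (diam G₁) + ℕtoℚ (diam G₂)) * (c * (K₁ * K₂))
        ≡⟨ *-harmonic (ℕtoℚ (diam G₁)) (ℕtoℚ (diam G₂)) K₁ K₂ c sharp₁ sharp₂ c[K₁+K₂]≡1 ⟩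
      ℕtoℚ 2 ∎
      where open ≡-Reasoning

proposition2 : (G₁ G₂ : Graph) →
    IsSimple G₁ → IsConnected G₁ → IsSimple G₂ → IsConnected G₂ →
    BMSharp G₁ → BMSharp G₂ → BMSharp (G₁ □ G₂)
proposition2 G₁ G₂ simple₁ connected₁ simple₂ connected₂
  (w₁ , curvature₁ , K₁ , min₁ , 0≤K₁ , sharp₁) (w₂ , curvature₂ , K₂ , min₂ , 0≤K₂ , sharp₂) =
  (λ x → c * (w₁ ⊗ w₂) x) ,
  isCurvature-⊗ connected₁ connected₂ c curvature₁ curvature₂
    (sum-sharp G₁ simple₁ connected₁ curvature₁ min₁ 0≤K₁ sharp₁)
    (sum-sharp G₂ simple₂ connected₂ curvature₂ min₂ 0≤K₂ sharp₂) c[K₁+K₂]≡1 ,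
  c * (K₁ * K₂) ,
  isMin-scale 0≤c (isMin-⊗ min₁ min₂ 0≤K₁ 0≤K₂) ,
  *-nonNeg 0≤c (*-nonNeg 0≤K₁ 0≤K₂) ,
  sharp-□ connected₁ connected₂ c sharp₁ sharp₂ c[K₁+K₂]≡1
  where
  open ProductCurvature G₁ G₂
  instance
    K₁+K₂>0 : Positive (K₁ + K₂)
    K₁+K₂>0 = pos+nonNeg⇒pos K₁ {{proj₂ (*≡2⇒positive (ℕtoℚ-nonNeg (diam G₁)) 0≤K₁ sharp₁)}}
                             K₂ {{nonNegative 0≤K₂}}
    K₁+K₂≢0 : NonZero (K₁ + K₂)
    K₁+K₂≢0 = pos⇒nonZero (K₁ + K₂)
  c : ℚ
  c = 1/ (K₁ + K₂)
  0≤c : 0ℚ ≤ c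
  0≤c = <⇒≤ (positive⁻¹ c {{1/pos⇒pos (K₁ + K₂)}})
  c[K₁+K₂]≡1 : c * (K₁ + K₂) ≡ 1ℚ
  c[K₁+K₂]≡1 = *-inverseˡ (K₁ + K₂)
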